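{- Let $n\ge1$, $w\in S_n$ with $w\ne w_0$, and let $(i,j)$ be an addable cell of $\mathrm{dom}(w)$ with $j=\alpha(w)$. Then: (1) $w<ws_i$; (2) $i+1\in\phi_i(w)$; (3) $\phi_i(w)\setminus\{i+1\}\subseteq\phi_{i+1}(ws_i)$; (4) for nonempty $U\subseteq\phi_i(w)$, $w_{U,i}$ has a descent at $i$ if and only if $w_{U,i}\ge ws_i$, if and only if $i+1\in U$; (5) for nonempty $U\subseteq\phi_{i+1}(ws_i)$, $(ws_i)_{U,i+1}$ has a descent at $i$ if and only if $U\subseteq\phi_i(w)$, and in this case $(ws_i)_{U,i+1}=w_{U\cup\{i+1\},i}$.
   Context: Permutations in $S_n$ are viewed as bijections of $\mathbb Z_{>0}$ fixing all integers $>n$; $s_i=(i\ i+1)$, $t_{a,b}=(a\ b)$, $w_0=n\,n-1\cdots1$ in $S_n$; $<$ and $\le$ denote Bruhat order; $v$ has a descent at $i$ if $v(i)>v(i+1)$. Rothe diagram $D(w)=\{(i,j):j<w(i),\ i<w^{ -1}(j)\}$; $\mathrm{dom}(w)$ is the largest Young diagram (top-left justified partition shape $\{(i,j):1\le j\le\lambda_i\}$) contained in $D(w)$; an addable cell of a Young diagram $Y$ is $(i,j)\notin Y$ with $(i-1,j)\in Y$ if $i>1$ and $(i,j-1)\in Y$ if $j>1$. For $w\ne w_0$, $\alpha(w)$ is the least $j$ such that $\mathrm{dom}(w)$ has an addable cell $(i,j)$ with $i+j\le n$. $\phi_i(w)=\{a>i:w(a)>w(i)$, and there is no $a'$ with $i<a'<a$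 and $w(i)<w(a')<w(a)\}$. For $U=\{i_1<\cdots<i_k\}\subseteq\phi_i(w)$, $w_{U,i}=wt_{i,i_k}t_{i,i_{k-1}}\cdots t_{i,i_1}$ (and $w_{\emptyset,i}=w$); $\overline\Phi_i(w)=\{w_{U,i}:\emptyset\ne U\subseteq\phi_i(w)\}$. -}

module Defs where

open import Data.Nat using (ℕ; zero; suc; _+_; _∸_; _≤_; _<_; _≡ᵇ_)
open import Data.Bool using (if_then_else_)
open import Data.Product using (Σ; ∃; _×_; _,_)
open import Data.List using (List; []; _∷_)
open import Data.List.Relation.Unary.All using (All)
open import Data.List.Relation.Unary.Linked using (Linked)
open import Relation.Binary.PropositionalEquality using (_≡_; _≗_)
open import Relation.Binary.Construct.Closure.ReflexiveTransitive using (Star)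
open import Relation.Nullary using (¬_)
open import Function using (_∘_)

-- Permutations of ℤ_{>0} are modelled as functions ℕ → ℕ; the value at 0 is
-- irrelevant and is required to be 0 (so 0 is fixed).
record Perm (n : ℕ) : Set where
  field
    fun    : ℕ → ℕ
    inv    : ℕ → ℕ
    inv∘fun : ∀ x → inv (fun x) ≡ x
    fun∘inv : ∀ x → fun (inv x) ≡ x
    fix0   : fun 0 ≡ 0
    fixBig : ∀ x → n < x → fun x ≡ x

open Perm public

t : ℕ → ℕ → ℕ → ℕ
t a b x = if x ≡ᵇ a then b else (if x ≡ᵇ b then a else x)

s : ℕ → ℕ → ℕ
s i = t i (suc i)

IsLongest : (n : ℕ) → Perm n → Set
IsLongest n w = ∀ x → 1 ≤ x → x ≤ n → fun w x ≡ suc n ∸ x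

-- Bruhat order: reflexive-transitive closure of v → v t_{a,b}
-- with a < b and v(a) < v(b) (i.e. ℓ(v t_{a,b}) > ℓ(v)).
BruhatStep : (ℕ → ℕ) → (ℕ → ℕ) → Set
BruhatStep v u = Σ ℕ λ a → Σ ℕ λ b →
  1 ≤ a × a < b × v a < v b × (u ≗ v ∘ t a b)

_≤B_ : (ℕ → ℕ) → (ℕ → ℕ) → Set
v ≤B u = Star BruhatStep v u

_<B_ : (ℕ → ℕ) → (ℕ → ℕ) → Set
v <B u = v ≤B u × ¬ (v ≗ u)

HasDescent : (ℕ → ℕ) → ℕ → Set
HasDescent v i = v (suc i) < v i

InRothe : ∀ {n} → Perm n → ℕ → ℕ → Set
InRothe w i j = 1 ≤ i × 1 ≤ j × j < fun w i × i < inv w j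

-- Young diagram given by row lengths λ (row i ≥ 1 has length λ i);
-- cells {(i,j) : i ≥ 1, 1 ≤ j ≤ λ i}. λ 0 is ignored.
IsPartition : (ℕ → ℕ) → Set
IsPartition λ′ = (∀ i → 1 ≤ i → λ′ (suc i) ≤ λ′ i) × (∃ λ N → ∀ i → N < i → λ′ i ≡ 0)

InYoung : (ℕ → ℕ) → ℕ → ℕ → Set
InYoung λ′ i j = 1 ≤ i × 1 ≤ j × j ≤ λ′ i

IsDom : ∀ {n} → Perm n → (ℕ → ℕ) → Set
IsDom w λ′ = IsPartition λ′
  × (∀ i j → InYoung λ′ i j → InRothe w i j)
  × (∀ μ → IsPartition μ → (∀ i j → InYoung μ i j → InRothe w i j)
         → ∀ i j → InYoung μ i j → InYoung λ′ i j)

Addable : (ℕ → ℕ) → ℕ → ℕ → Set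
Addable λ′ i j = 1 ≤ i × 1 ≤ j × ¬ InYoung λ′ i j
  × (1 < i → InYoung λ′ (i ∸ 1) j)
  × (1 < j → InYoung λ′ i (j ∸ 1))

IsAlpha : ℕ → (ℕ → ℕ) → ℕ → Set
IsAlpha n λ′ j = (∃ λ i → Addable λ′ i j × i + j ≤ n)
  × (∀ i′ j′ → Addable λ′ i′ j′ → i′ + j′ ≤ n → j ≤ j′)

InPhi : (ℕ → ℕ) → ℕ → ℕ → Set
InPhi v i a = i < a × v i < v a
  × (∀ a′ → i < a′ → a′ < a → ¬ (v i < v a′ × v a′ < v a))

-- finite subsets U of ℤ_{>0} are represented by strictly increasing lists
SortedSet : List ℕ → Set
SortedSet U = Linked _<_ U

-- w_{U,i} = w t_{i,i_k} ⋯ t_{i,i_1} for U = [i_1 < ⋯ < i_k]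
wU : (ℕ → ℕ) → ℕ → List ℕ → ℕ → ℕ
wU v i []      = v
wU v i (a ∷ U) = wU v i U ∘ t i a

-- The heart is the ascent w(i) < w(i+1). Otherwise, with r = λ(i+1) the length of row i+1
-- of dom(w), we get r < w(i+1) < w(i) ≤ j (the last step because the addable cell (i,j) of
-- dom(w) lies outside D(w) by maximality), so (i+1, r+1) is an addable cell of dom(w) in a
-- column r+1 < j with (i+1)+(r+1) ≤ i+j ≤ n, contradicting the minimality of j = α(w).
--
-- Everything else holds for any permutation v with an ascent at i. The values of v on φ_i(v)
-- decrease with position, so v_{U,i} is reached from v by a chain of Bruhat steps; the
-- conjugation s_i t_{i+1,a} s_i = t_{i,a} identifies (v s_i)_{U,i+1} with v_{U∪{i+1},i}; and
-- each Bruhat step increases the one-line notation lexicographically, so when i+1 ∉ U the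
-- permutation v_{U,i}, which agrees with v s_i before position i and is smaller at i, does
-- not lie above v s_i.

module Submission where

open import Defs
open import Data.Nat
open import Data.Nat.Properties
open import Data.Bool using (true; false)
open import Data.Bool.Properties using (T-≡; ¬-not)
open import Data.Product using (∃; _×_; _,_; proj₁; proj₂)
open import Data.Sum using (_⊎_; inj₁; inj₂)
open import Data.List using (List; []; _∷_)
open import Data.List.Relation.Unary.All as All using (All; []; _∷_)
open import Data.List.Relation.Unary.AllPairs using (AllPairs; []; _∷_)
open import Data.List.Relation.Unary.Any using (here)
open import Data.List.Relation.Unary.Linked.Properties using (Linked⇒AllPairs)
open import Data.List.Membership.Propositional using (_∈_; _∉_)
open import Data.Empty using (⊥-elim)
open import Function using (_∘_; _⇔_; mk⇔; const; Equivalence)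
open import Function.Definitions using (Injective)
open import Relation.Binary.PropositionalEquality
open import Relation.Binary.Construct.Closure.ReflexiveTransitive using (ε; _◅_; _◅◅_)
open import Relation.Binary.Definitions using (tri<; tri≈; tri>)
open import Relation.Nullary using (¬_; yes; no)

≡ᵇ-refl : ∀ a → (a ≡ᵇ a) ≡ true
≡ᵇ-refl a = Equivalence.to T-≡ (≡⇒≡ᵇ a a refl)

≢⇒≡ᵇ-false : ∀ {x a} → x ≢ a → (x ≡ᵇ a) ≡ false
≢⇒≡ᵇ-false {x} {a} x≢a = ¬-not (x≢a ∘ ≡ᵇ⇒≡ x a ∘ Equivalence.from T-≡)

t-left : ∀ a b → t a b a ≡ b
t-left a b rewrite ≡ᵇ-refl a = refl

t-right : ∀ a b → t a b b ≡ a
t-right a b with b ≟ a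
... | yes refl = t-left a a
... | no b≢a rewrite ≢⇒≡ᵇ-false b≢a | ≡ᵇ-refl b = refl

t-fix : ∀ {a b x} → x ≢ a → x ≢ b → t a b x ≡ x
t-fix x≢a x≢b rewrite ≢⇒≡ᵇ-false x≢a | ≢⇒≡ᵇ-false x≢b = refl

t-involutive : ∀ a b x → t a b (t a b x) ≡ x
t-involutive a b x with x ≟ a | x ≟ b
... | yes refl | _        = trans (cong (t x b) (t-left x b)) (t-right x b)
... | no _     | yes refl = trans (cong (t a x) (t-right a x)) (t-left a x)
... | no x≢a   | no x≢b   = trans (cong (t a b) (t-fix x≢a x≢b)) (t-fix x≢a x≢b)

t-injective : ∀ a b → Injective _≡_ _≡_ (t a b)
t-injective a b {x} {y} e = begin
  x               ≡⟨ t-involutive a b x ⟨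
  t a b (t a b x) ≡⟨ cong (t a b) e ⟩
  t a b (t a b y) ≡⟨ t-involutive a b y ⟩
  y               ∎
  where open ≡-Reasoning

s-at-i : ∀ i → s i i ≡ suc i
s-at-i i = t-left i (suc i)

s-at-suc : ∀ i → s i (suc i) ≡ i
s-at-suc i = t-right i (suc i)

s-below : ∀ {i x} → x < i → s i x ≡ x
s-below x<i = t-fix (<⇒≢ x<i) (<⇒≢ (m<n⇒m<1+n x<i))

s-above : ∀ {i x} → suc i < x → s i x ≡ x
s-above 1+i<x = t-fix (>⇒≢ (<-trans (n<1+n _) 1+i<x)) (>⇒≢ 1+i<x)

s-t-conj : ∀ {i a} x → suc i < a → s i (t (suc i) a x) ≡ t i a (s i x)
s-t-conj {i} {a} x 1+i<a with x ≟ i | x ≟ suc i | x ≟ a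
... | yes refl | _ | _ = begin
  s x (t (suc x) a x) ≡⟨ cong (s x) (t-fix (<⇒≢ (n<1+n x)) (<⇒≢ i<a)) ⟩
  s x x               ≡⟨ s-at-i x ⟩
  suc x               ≡⟨ t-fix (>⇒≢ (n<1+n x)) (<⇒≢ 1+i<a) ⟨
  t x a (suc x)       ≡⟨ cong (t x a) (s-at-i x) ⟨
  t x a (s x x)       ∎
  where
  open ≡-Reasoning
  i<a : x < a
  i<a = <-trans (n<1+n x) 1+i<a
... | no _ | yes refl | _ = begin
  s i (t x a x) ≡⟨ cong (s i) (t-left x a) ⟩
  s i a         ≡⟨ s-above 1+i<a ⟩
  a             ≡⟨ t-left i a ⟨
  t i a i       ≡⟨ cong (t i a) (s-at-suc i) ⟨
  t i a (s i x) ∎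
  where open ≡-Reasoning
... | no x≢i | no x≢1+i | yes refl = begin
  s i (t (suc i) x x) ≡⟨ cong (s i) (t-right (suc i) x) ⟩
  s i (suc i)         ≡⟨ s-at-suc i ⟩
  i                   ≡⟨ t-right i x ⟨
  t i x x             ≡⟨ cong (t i x) (t-fix x≢i x≢1+i) ⟨
  t i x (s i x)       ∎
  where open ≡-Reasoning
... | no x≢i | no x≢1+i | no x≢a = begin
  s i (t (suc i) a x) ≡⟨ cong (s i) (t-fix x≢1+i x≢a) ⟩
  s i x               ≡⟨ t-fix x≢i x≢1+i ⟩
  x                   ≡⟨ t-fix x≢i x≢a ⟨
  t i a x             ≡⟨ cong (t i a) (t-fix x≢i x≢1+i) ⟨
  t i a (s i x)       ∎
  where open ≡-Reasoning

All<-∷ : ∀ {x a U} → x < a → All (a <_) U → All (x <_) (a ∷ U)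
All<-∷ x<a a<U = x<a ∷ All.map (<-trans x<a) a<U

All<⇒∉ : ∀ {x U} → All (x <_) U → x ∉ U
All<⇒∉ x<U x∈U = <-irrefl refl (All.lookup x<U x∈U)

wU-below : ∀ v c U {x} → x ≢ c → All (x <_) U → wU v c U x ≡ v x
wU-below v c []      x≢c []           = refl
wU-below v c (a ∷ U) x≢c (x<a ∷ x<U) =
  trans (cong (wU v c U) (t-fix x≢c (<⇒≢ x<a))) (wU-below v c U x≢c x<U)

wU-head : ∀ v c {a U} → a ≢ c → All (a <_) U → wU v c (a ∷ U) c ≡ v a
wU-head v c {a} {U} a≢c a<U = trans (cong (wU v c U) (t-left c a)) (wU-below v c U a≢c a<U)

wU-s-conj : ∀ v {i} U x → All (suc i <_) U → wU (v ∘ s i) (suc i) U x ≡ wU v i U (s i x)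
wU-s-conj v []      x []             = refl
wU-s-conj v (a ∷ U) x (1+i<a ∷ 1+i<U) =
  trans (wU-s-conj v U (t _ a x) 1+i<U) (cong (wU v _ U) (s-t-conj x 1+i<a))

InPhi-decreasing : ∀ {v c a b} → Injective _≡_ _≡_ v
                 → InPhi v c a → InPhi v c b → a < b → v b < v a
InPhi-decreasing {v} {a = a} {b} v-injective (c<a , vc<va , _) (_ , vc<vb , no-between) a<b
  with <-cmp (v a) (v b)
... | tri< va<vb _ _ = ⊥-elim (no-between a c<a a<b (vc<va , va<vb))
... | tri≈ _ va≡vb _ = ⊥-elim (<⇒≢ a<b (v-injective va≡vb))
... | tri> _ _ vb<va = vb<va

InPhi-s : ∀ {v i a} → InPhi v i a → a ≢ suc i → InPhi (v ∘ s i) (suc i) a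
InPhi-s {v} {i} {a} (i<a , vi<va , no-between) a≢1+i =
  1+i<a , subst₂ _<_ (sym vs-at-suc) (sym (vs-above 1+i<a)) vi<va , no-between′
  where
  vs-at-suc : v (s i (suc i)) ≡ v i
  vs-at-suc = cong v (s-at-suc i)
  vs-above : ∀ {x} → suc i < x → v (s i x) ≡ v x
  vs-above = cong v ∘ s-above
  1+i<a : suc i < a
  1+i<a = ≤∧≢⇒< i<a (a≢1+i ∘ sym)
  no-between′ : ∀ a′ → suc i < a′ → a′ < a
              → ¬ (v (s i (suc i)) < v (s i a′) × v (s i a′) < v (s i a))
  no-between′ a′ 1+i<a′ a′<a (l , r) = no-between a′ (<-trans (n<1+n i) 1+i<a′) a′<a
    (subst₂ _<_ vs-at-suc (vs-above 1+i<a′) l , subst₂ _<_ (vs-above 1+i<a′) (vs-above 1+i<a) r)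

InPhi-s⁻¹ : ∀ {v i b} → InPhi (v ∘ s i) (suc i) b → v (s i b) < v (s i i) → InPhi v i b
InPhi-s⁻¹ {v} {i} {b} (1+i<b , vi<vb , no-between) vb<vi+1 =
  <-trans (n<1+n i) 1+i<b , subst₂ _<_ vs-at-suc (vs-above 1+i<b) vi<vb , no-between′
  where
  vs-at-suc : v (s i (suc i)) ≡ v i
  vs-at-suc = cong v (s-at-suc i)
  vs-above : ∀ {x} → suc i < x → v (s i x) ≡ v x
  vs-above = cong v ∘ s-above
  no-between′ : ∀ a′ → i < a′ → a′ < b → ¬ (v i < v a′ × v a′ < v b)
  no-between′ a′ i<a′ a′<b (l , r) with m≤n⇒m<n∨m≡n i<a′
  ... | inj₂ refl   = <-asym r (subst₂ _<_ (vs-above 1+i<b) (cong v (s-at-i i)) vb<vi+1)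
  ... | inj₁ 1+i<a′ = no-between a′ 1+i<a′ a′<b
    (subst₂ _<_ (sym vs-at-suc) (sym (vs-above 1+i<a′)) l ,
     subst₂ _<_ (sym (vs-above 1+i<a′)) (sym (vs-above 1+i<b)) r)

InPhi-head-max : ∀ {v c a U} → Injective _≡_ _≡_ v → AllPairs _<_ (a ∷ U) → All (InPhi v c) (a ∷ U)
               → All (λ b → v b ≤ v a) (a ∷ U)
InPhi-head-max v-injective (a<U ∷ _) (φa ∷ φU) =
  ≤-refl ∷ All.zipWith (λ (a<b , φb) → <⇒≤ (InPhi-decreasing v-injective φa φb a<b)) (a<U , φU)

_≤lex_ : (ℕ → ℕ) → (ℕ → ℕ) → Set
u ≤lex v = ∀ p → (∀ x → x < p → u x ≡ v x) → u p ≤ v p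

≤lex-squeeze : ∀ {u v w} → u ≤lex v → v ≤lex w
             → ∀ p → (∀ x → x < p → u x ≡ w x) → ∀ x → x < p → u x ≡ v x
≤lex-squeeze {u} {v} {w} u≤v v≤w (suc p) u≡w x x<1+p with m<1+n⇒m<n∨m≡n x<1+p
... | inj₁ x<p  = ≤lex-squeeze u≤v v≤w p (λ y → u≡w y ∘ m<n⇒m<1+n) x x<p
... | inj₂ refl = ≤-antisym (u≤v x u≡v) (≤-trans (v≤w x v≡w) (≤-reflexive (sym (u≡w x x<1+p))))
  where
  u≡v : ∀ y → y < x → u y ≡ v y
  u≡v = ≤lex-squeeze u≤v v≤w x (λ y → u≡w y ∘ m<n⇒m<1+n)
  v≡w : ∀ y → y < x → v y ≡ w y
  v≡w y y<x = trans (sym (u≡v y y<x)) (u≡w y (m<n⇒m<1+n y<x))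

≤lex-trans : ∀ {u v w} → u ≤lex v → v ≤lex w → u ≤lex w
≤lex-trans {u} {v} {w} u≤v v≤w p u≡w = ≤-trans (u≤v p u≡v) (v≤w p v≡w)
  where
  u≡v : ∀ x → x < p → u x ≡ v x
  u≡v = ≤lex-squeeze u≤v v≤w p u≡w
  v≡w : ∀ x → x < p → v x ≡ w x
  v≡w x x<p = trans (sym (u≡v x x<p)) (u≡w x x<p)

BruhatStep⇒≤lex : ∀ {v u} → BruhatStep v u → v ≤lex u
BruhatStep⇒≤lex {v} {u} (a , b , _ , a<b , va<vb , u≗) p v≡u with p ≟ a | p ≟ b
... | yes refl | _        = <⇒≤ (subst (v p <_) (sym (trans (u≗ p) (cong v (t-left p b)))) va<vb)
... | no _     | yes refl = ⊥-elim (<⇒≢ va<vb (trans (v≡u a a<b) (trans (u≗ a) (cong v (t-left a p)))))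
... | no p≢a   | no p≢b   = ≤-reflexive (sym (trans (u≗ p) (cong v (t-fix p≢a p≢b))))

≤B⇒≤lex : ∀ {v u} → v ≤B u → v ≤lex u
≤B⇒≤lex ε              _ _ = ≤-refl
≤B⇒≤lex (step ◅ steps) = ≤lex-trans (BruhatStep⇒≤lex step) (≤B⇒≤lex steps)

module _ {v : ℕ → ℕ} (v-injective : Injective _≡_ _≡_ v) {c : ℕ} where

  wU-c<head : ∀ {a U} → InPhi v c a → All (a <_) U → AllPairs _<_ U → All (InPhi v c) U
            → wU v c U c < v a
  wU-c<head φa []            []           []        = proj₁ (proj₂ φa)
  wU-c<head φa (a<b ∷ _) (b<U ∷ _) (φb ∷ _) =
    subst (_< _) (sym (wU-head v c (>⇒≢ (proj₁ φb)) b<U)) (InPhi-decreasing v-injective φa φb a<b)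

  ≤B-wU   : 1 ≤ c → ∀ U → AllPairs _<_ U → All (InPhi v c) U → v ≤B wU v c U
  ≤B-wU-∷ : 1 ≤ c → ∀ {a U h} → AllPairs _<_ (a ∷ U) → All (InPhi v c) (a ∷ U)
          → h ≗ wU v c (a ∷ U) → v ≤B h

  ≤B-wU _   []      _  _  = ε
  ≤B-wU 1≤c (_ ∷ _) U↑ φU = ≤B-wU-∷ 1≤c U↑ φU (λ _ → refl)

  ≤B-wU-∷ 1≤c {a} {U} (a<U ∷ U↑) (φa@(c<a , _) ∷ φU) h≗ =
    ≤B-wU 1≤c U U↑ φU ◅◅ ((c , a , 1≤c , c<a , last-step , h≗) ◅ ε)
    where
    last-step : wU v c U c < wU v c U a
    last-step = subst (_ <_) (sym (wU-below v c U (>⇒≢ c<a) a<U)) (wU-c<head φa a<U U↑ φU)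

Addable⇒row-end : ∀ {λ′ i j} → Addable λ′ i j → j ≡ suc (λ′ i)
Addable⇒row-end {λ′} {i} {j} (1≤i , 1≤j , ∉λ′ , _ , left) = ≤-antisym (j≤1+λ′i j left) λ′i<j
  where
  λ′i<j : λ′ i < j
  λ′i<j = ≰⇒> (λ j≤λ′i → ∉λ′ (1≤i , 1≤j , j≤λ′i))
  j≤1+λ′i : ∀ j → (1 < j → InYoung λ′ i (j ∸ 1)) → j ≤ suc (λ′ i)
  j≤1+λ′i zero          _    = z≤n
  j≤1+λ′i (suc zero)    _    = s≤s z≤n
  j≤1+λ′i (suc (suc k)) left = s≤s (proj₂ (proj₂ (left (s≤s (s≤s z≤n)))))

addable-after-row : ∀ {λ′ i} → 1 ≤ i → suc (λ′ (suc i)) ≤ λ′ i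
                  → Addable λ′ (suc i) (suc (λ′ (suc i)))
addable-after-row 1≤i longer =
  s≤s z≤n , s≤s z≤n , (λ (_ , _ , r+1≤r) → 1+n≰n r+1≤r)
  , (λ _ → 1≤i , s≤s z≤n , longer) , (λ 1<r+1 → s≤s z≤n , ≤-pred 1<r+1 , ≤-refl)

growRow : (ℕ → ℕ) → ℕ → ℕ → ℕ
growRow λ′ i x with x ≟ i
... | yes _ = suc (λ′ i)
... | no _  = λ′ x

growRow-here : ∀ λ′ i → growRow λ′ i i ≡ suc (λ′ i)
growRow-here λ′ i with i ≟ i
... | yes _  = refl
... | no i≢i = ⊥-elim (i≢i refl)

InYoung-growRow : ∀ {λ′ i x y} → InYoung (growRow λ′ i) x y
                → InYoung λ′ x y ⊎ (x ≡ i × y ≡ suc (λ′ i))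
InYoung-growRow {λ′} {i} {x} {y} (1≤x , 1≤y , y≤) with x ≟ i
... | no _     = inj₁ (1≤x , 1≤y , y≤)
... | yes refl with m≤n⇒m<n∨m≡n y≤
...   | inj₁ y<  = inj₁ (1≤x , 1≤y , ≤-pred y<)
...   | inj₂ y≡  = inj₂ (refl , y≡)

module _ {λ′ : ℕ → ℕ} (antitone₁ : ∀ i → 1 ≤ i → λ′ (suc i) ≤ λ′ i) where

  antitone : ∀ {x y} → 1 ≤ x → x ≤ y → λ′ y ≤ λ′ x
  antitone {x} 1≤x x≤y = go (≤⇒≤′ x≤y)
    where
    go : ∀ {y} → x ≤′ y → λ′ y ≤ λ′ x
    go ≤′-refl        = ≤-refl
    go (≤′-step x≤′y) = ≤-trans (antitone₁ _ (≤-trans 1≤x (≤′⇒≤ x≤′y))) (go x≤′y)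

  ¬addable-below : ∀ {i i′ j} → i < i′ → Addable λ′ i j → ¬ Addable λ′ i′ j
  ¬addable-below i<i′ ad@(1≤i , _) (_ , _ , _ , up , _) =
    <⇒≱ (≤-reflexive (sym (Addable⇒row-end {λ′} ad)))
        (≤-trans (proj₂ (proj₂ (up (≤-trans (s≤s 1≤i) i<i′)))) (antitone 1≤i (<⇒≤pred i<i′)))

  addable-column-unique : ∀ {i i′ j} → Addable λ′ i j → Addable λ′ i′ j → i ≡ i′
  addable-column-unique ad ad′ with <-cmp _ _
  ... | tri< i<i′ _ _ = ⊥-elim (¬addable-below i<i′ ad ad′)
  ... | tri≈ _ i≡i′ _ = i≡i′
  ... | tri> _ _ i′<i = ⊥-elim (¬addable-below i′<i ad′ ad)

  growRow-isPartition : ∀ {i j} → (∃ λ N → ∀ x → N < x → λ′ x ≡ 0) → Addable λ′ i j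
                      → IsPartition (growRow λ′ i)
  growRow-isPartition {i} (N , vanish) ad@(_ , _ , _ , up , _) = antitone₁′ , (N + i , vanish′)
    where
    antitone₁′ : ∀ x → 1 ≤ x → growRow λ′ i (suc x) ≤ growRow λ′ i x
    antitone₁′ x 1≤x with suc x ≟ i | x ≟ i
    ... | yes refl | yes x≡1+x = ⊥-elim (1+n≢n (sym x≡1+x))
    ... | yes refl | no _      = subst (_≤ λ′ x) (Addable⇒row-end {λ′} ad)
                                   (proj₂ (proj₂ (up (s≤s 1≤x))))
    ... | no _     | yes refl = m≤n⇒m≤1+n (antitone₁ x 1≤x)
    ... | no _     | no _     = antitone₁ x 1≤x
    vanish′ : ∀ x → N + i < x → growRow λ′ i x ≡ 0
    vanish′ x N+i<x with x ≟ i
    ... | yes refl = ⊥-elim (<⇒≱ N+i<x (m≤n+m x N))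
    ... | no _     = vanish x (≤-<-trans (m≤m+n N i) N+i<x)

Perm-injective : ∀ {n} (w : Perm n) → Injective _≡_ _≡_ (fun w)
Perm-injective w {x} {y} wx≡wy = begin
  x                 ≡⟨ inv∘fun w x ⟨
  inv w (fun w x)   ≡⟨ cong (inv w) wx≡wy ⟩
  inv w (fun w y)   ≡⟨ inv∘fun w y ⟩
  y                 ∎
  where open ≡-Reasoning

fun-positive : ∀ {n} (w : Perm n) {x} → 1 ≤ x → 1 ≤ fun w x
fun-positive w 1≤x =
  n≢0⇒n>0 (λ wx≡0 → >⇒≢ 1≤x (Perm-injective w (trans wx≡0 (sym (fix0 w)))))

inv-positive : ∀ {n} (w : Perm n) {y} → 1 ≤ y → 1 ≤ inv w y
inv-positive w {y} 1≤y =
  n≢0⇒n>0 (λ w⁻¹y≡0 → >⇒≢ 1≤y (trans (sym (fun∘inv w y)) (trans (cong (fun w) w⁻¹y≡0) (fix0 w))))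

module _ {n} {w : Perm n} {λ′ : ℕ → ℕ} where

  IsDom⇒row<fun : IsDom w λ′ → ∀ {x} → 1 ≤ x → λ′ x < fun w x
  IsDom⇒row<fun (_ , λ′⊆D , _) {x} 1≤x with λ′ x in eq
  ... | zero  = fun-positive w 1≤x
  ... | suc r = proj₁ (proj₂ (proj₂ (λ′⊆D x (suc r) (1≤x , s≤s z≤n , ≤-reflexive (sym eq)))))

  IsDom⇒addable∉Rothe : ∀ {i j} → IsDom w λ′ → Addable λ′ i j → ¬ InRothe w i j
  IsDom⇒addable∉Rothe {i} {j} ((antitone₁ , vanish) , λ′⊆D , maximal) ad@(1≤i , 1≤j , ∉λ′ , _) ij∈D =
    ∉λ′ (maximal (growRow λ′ i) (growRow-isPartition antitone₁ vanish ad) grown⊆D i j (1≤i , 1≤j , j≤))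
    where
    j≤ : j ≤ growRow λ′ i i
    j≤ = ≤-reflexive (trans (Addable⇒row-end {λ′} ad) (sym (growRow-here λ′ i)))
    grown⊆D : ∀ x y → InYoung (growRow λ′ i) x y → InRothe w x y
    grown⊆D x y cell with InYoung-growRow cell
    ... | inj₁ old           = λ′⊆D x y old
    ... | inj₂ (refl , refl) = subst (InRothe w i) (Addable⇒row-end {λ′} ad) ij∈D

  Addable⇒row≤inv : ∀ {i j} → (∀ x y → InYoung λ′ x y → InRothe w x y) → Addable λ′ i j → i ≤ inv w j
  Addable⇒row≤inv {suc zero}    _    (_ , 1≤j , _)          = inv-positive w 1≤j
  Addable⇒row≤inv {suc (suc k)} λ′⊆D (_ , _ , _ , up , _) =
    proj₂ (proj₂ (proj₂ (λ′⊆D (suc k) _ (up (s≤s (s≤s z≤n))))))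

  IsDom⇒fun≤addable : ∀ {i j} → IsDom w λ′ → Addable λ′ i j → fun w i ≤ j
  IsDom⇒fun≤addable {i} {j} dom@(_ , λ′⊆D , _) ad@(1≤i , 1≤j , _) = ≮⇒≥ j≮wi
    where
    j≮wi : ¬ j < fun w i
    j≮wi j<wi = <-irrefl (sym wi≡j) j<wi
      where
      w⁻¹j≤i : inv w j ≤ i
      w⁻¹j≤i = ≮⇒≥ (λ i<w⁻¹j → IsDom⇒addable∉Rothe dom ad (1≤i , 1≤j , j<wi , i<w⁻¹j))
      wi≡j : fun w i ≡ j
      wi≡j = trans (cong (fun w) (≤-antisym (Addable⇒row≤inv λ′⊆D ad) w⁻¹j≤i)) (fun∘inv w j)

  IsAlpha⇒addable-sum≤ : ∀ {i j} → IsPartition λ′ → IsAlpha n λ′ j → Addable λ′ i j → i + j ≤ n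
  IsAlpha⇒addable-sum≤ (antitone₁ , _) ((_ , ad′ , i′+j≤n) , _) ad =
    subst (λ x → x + _ ≤ n) (addable-column-unique antitone₁ ad′ ad) i′+j≤n

  ascent-at-alpha : ∀ {i j} → IsDom w λ′ → Addable λ′ i j → IsAlpha n λ′ j → fun w i < fun w (suc i)
  ascent-at-alpha {i} {j} dom@(part , _) ad@(1≤i , _) α@(_ , minimal)
    with <-cmp (fun w i) (fun w (suc i))
  ... | tri< ascent _ _  = ascent
  ... | tri≈ _ wi≡wi+1 _ = ⊥-elim (1+n≢n (sym (Perm-injective w wi≡wi+1)))
  ... | tri> _ _ descent = ⊥-elim (<⇒≱ r+1<j (minimal (suc i) (suc r) ad′ sum≤n))
    where
    open ≤-Reasoning
    r : ℕ
    r = λ′ (suc i)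
    r+1<j : suc r < j
    r+1<j = begin-strict
      suc r          ≤⟨ IsDom⇒row<fun dom (s≤s z≤n) ⟩
      fun w (suc i)  <⟨ descent ⟩
      fun w i        ≤⟨ IsDom⇒fun≤addable dom ad ⟩
      j              ∎
    ad′ : Addable λ′ (suc i) (suc r)
    ad′ = addable-after-row {λ′} 1≤i (≤-pred (subst (suc r <_) (Addable⇒row-end {λ′} ad) r+1<j))
    sum≤n : suc i + suc r ≤ n
    sum≤n = begin
      suc i + suc r    ≡⟨ +-suc i (suc r) ⟨
      i + suc (suc r)  ≤⟨ +-monoʳ-≤ i r+1<j ⟩
      i + j            ≤⟨ IsAlpha⇒addable-sum≤ part α ad ⟩
      n                ∎

ascent⇒<B : ∀ {v i} → 1 ≤ i → v i < v (suc i) → v <B (v ∘ s i)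
ascent⇒<B {v} {i} 1≤i ascent =
  (i , suc i , 1≤i , n<1+n i , ascent , (λ _ → refl)) ◅ ε ,
  λ v≗vsᵢ → <⇒≢ ascent (trans (v≗vsᵢ i) (cong v (s-at-i i)))

ascent⇒suc∈φ : ∀ {v i} → v i < v (suc i) → InPhi v i (suc i)
ascent⇒suc∈φ {i = i} ascent = n<1+n i , ascent , λ _ i<a′ a′<1+i _ → <⇒≱ a′<1+i i<a′

module _ {v : ℕ → ℕ} (v-injective : Injective _≡_ _≡_ v) {i : ℕ} (ascent : v i < v (suc i)) where

  vsᵢ-injective : Injective _≡_ _≡_ (v ∘ s i)
  vsᵢ-injective = t-injective i (suc i) ∘ v-injective

  InPhi⇒<suc : ∀ {a} → suc i < a → InPhi v i a → v a < v (suc i)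
  InPhi⇒<suc 1+i<a φa = InPhi-decreasing v-injective (ascent⇒suc∈φ ascent) φa 1+i<a

  wU-suc-descent : ∀ {U} → All (suc i <_) U → AllPairs _<_ U → All (InPhi v i) U
                 → HasDescent (wU v i (suc i ∷ U)) i
  wU-suc-descent {U} 1+i<U U↑ φU = begin-strict
    wU v i U (s i (suc i)) ≡⟨ cong (wU v i U) (s-at-suc i) ⟩
    wU v i U i             <⟨ wU-c<head v-injective (ascent⇒suc∈φ ascent) 1+i<U U↑ φU ⟩
    v (suc i)              ≡⟨ wU-head v i 1+n≢n 1+i<U ⟨
    wU v i (suc i ∷ U) i   ∎
    where open ≤-Reasoning

  vsᵢ≤B-wU-suc : ∀ {U} → All (suc i <_) U → AllPairs _<_ U → All (InPhi v i) U
               → (v ∘ s i) ≤B wU v i (suc i ∷ U)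
  vsᵢ≤B-wU-suc []  _ _ = ε
  vsᵢ≤B-wU-suc {U} 1+i<U@(_ ∷ _) U↑ φU =
    ≤B-wU-∷ vsᵢ-injective (s≤s z≤n) U↑ φU′ (λ x → sym (wU-s-conj v U x 1+i<U))
    where
    φU′ : All (InPhi (v ∘ s i) (suc i)) U
    φU′ = All.zipWith (λ (φa , 1+i<a) → InPhi-s φa (>⇒≢ 1+i<a)) (φU , 1+i<U)

  wU-¬descent : ∀ {a U} → suc i < a → All (a <_) U → InPhi v i a → ¬ HasDescent (wU v i (a ∷ U)) i
  wU-¬descent {a} {U} 1+i<a a<U φa descent = <-asym (InPhi⇒<suc 1+i<a φa) (subst₂ _<_
    (wU-below v i (a ∷ U) 1+n≢n (All<-∷ 1+i<a a<U))
    (wU-head v i (>⇒≢ (<-trans (n<1+n i) 1+i<a)) a<U)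
    descent)

  vsᵢ≰B-wU : ∀ {a U} → suc i < a → All (a <_) U → InPhi v i a → ¬ ((v ∘ s i) ≤B wU v i (a ∷ U))
  vsᵢ≰B-wU {a} {U} 1+i<a a<U φa vsᵢ≤B = <⇒≱ (InPhi⇒<suc 1+i<a φa) (subst₂ _≤_
    (cong v (s-at-i i))
    (wU-head v i (>⇒≢ (<-trans (n<1+n i) 1+i<a)) a<U)
    (≤B⇒≤lex vsᵢ≤B i agree))
    where
    agree : ∀ x → x < i → v (s i x) ≡ wU v i (a ∷ U) x
    agree x x<i = trans (cong v (s-below x<i))
      (sym (wU-below v i (a ∷ U) (<⇒≢ x<i) (All<-∷ (<-trans x<i (<-trans (n<1+n i) 1+i<a)) a<U)))

  descent⇔≤B⇔∈ : ∀ {U} → AllPairs _<_ U → U ≢ [] → All (InPhi v i) U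
               → (HasDescent (wU v i U) i ⇔ (v ∘ s i) ≤B wU v i U) × ((v ∘ s i) ≤B wU v i U ⇔ suc i ∈ U)
  descent⇔≤B⇔∈ {[]} _ []≢[] _ = ⊥-elim ([]≢[] refl)
  descent⇔≤B⇔∈ {a ∷ U} (a<U ∷ U↑) _ (φa ∷ φU) with a ≟ suc i
  ... | yes refl = mk⇔ (const vsᵢ≤B) (const descent) , mk⇔ (const (here refl)) (const vsᵢ≤B)
    where
    descent : HasDescent (wU v i (suc i ∷ U)) i
    descent = wU-suc-descent a<U U↑ φU
    vsᵢ≤B : (v ∘ s i) ≤B wU v i (suc i ∷ U)
    vsᵢ≤B = vsᵢ≤B-wU-suc a<U U↑ φU
  ... | no a≢1+i =
    mk⇔ (⊥-elim ∘ wU-¬descent 1+i<a a<U φa) (⊥-elim ∘ vsᵢ≰B-wU 1+i<a a<U φa) ,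
    mk⇔ (⊥-elim ∘ vsᵢ≰B-wU 1+i<a a<U φa) (⊥-elim ∘ All<⇒∉ (All<-∷ 1+i<a a<U))
    where
    1+i<a : suc i < a
    1+i<a = ≤∧≢⇒< (proj₁ φa) (a≢1+i ∘ sym)

  wU-sᵢ-descent⇔ : ∀ {U} → AllPairs _<_ U → U ≢ [] → All (InPhi (v ∘ s i) (suc i)) U
                 → HasDescent (wU (v ∘ s i) (suc i) U) i ⇔ All (InPhi v i) U
  wU-sᵢ-descent⇔ {[]} _ []≢[] _ = ⊥-elim ([]≢[] refl)
  wU-sᵢ-descent⇔ {a ∷ U} aU↑@(a<U ∷ _) _ φaU@(φa@(1+i<a , _) ∷ _) = mk⇔ to from
    where
    X : ℕ → ℕ
    X = wU (v ∘ s i) (suc i) (a ∷ U)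
    X-at-suc : X (suc i) ≡ v (s i a)
    X-at-suc = wU-head (v ∘ s i) (suc i) (>⇒≢ 1+i<a) a<U
    X-at-i : X i ≡ v (s i i)
    X-at-i = wU-below (v ∘ s i) (suc i) (a ∷ U) (<⇒≢ (n<1+n i)) (All<-∷ (<-trans (n<1+n i) 1+i<a) a<U)
    to : HasDescent X i → All (InPhi v i) (a ∷ U)
    to descent = All.zipWith (λ (φb , Vb≤Va) → InPhi-s⁻¹ φb (≤-<-trans Vb≤Va Va<Vi))
                             (φaU , InPhi-head-max vsᵢ-injective aU↑ φaU)
      where
      Va<Vi : v (s i a) < v (s i i)
      Va<Vi = subst₂ _<_ X-at-suc X-at-i descent
    from : All (InPhi v i) (a ∷ U) → HasDescent X i
    from (φ′a ∷ _) = subst₂ _<_ (sym (trans X-at-suc (cong v (s-above 1+i<a))))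
                                (sym (trans X-at-i (cong v (s-at-i i))))
                                (InPhi⇒<suc 1+i<a φ′a)

lemma6p1 : (n : ℕ) → 1 ≤ n → (w : Perm n) → ¬ IsLongest n w
    → (λ′ : ℕ → ℕ) → IsDom w λ′
    → (i j : ℕ) → Addable λ′ i j → IsAlpha n λ′ j
    → (fun w <B (fun w ∘ s i))
      × InPhi (fun w) i (suc i)
      × (∀ a → InPhi (fun w) i a → a ≢ suc i → InPhi (fun w ∘ s i) (suc i) a)
      × (∀ (U : List ℕ) → SortedSet U → U ≢ [] → All (InPhi (fun w) i) U
          → (HasDescent (wU (fun w) i U) i ⇔ (fun w ∘ s i) ≤B wU (fun w) i U)
            × ((fun w ∘ s i) ≤B wU (fun w) i U ⇔ suc i ∈ U))
      × (∀ (U : List ℕ) → SortedSet U → U ≢ [] → All (InPhi (fun w ∘ s i) (suc i)) U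
          → (HasDescent (wU (fun w ∘ s i) (suc i) U) i ⇔ All (InPhi (fun w) i) U)
            × (All (InPhi (fun w) i) U
               → wU (fun w ∘ s i) (suc i) U ≗ wU (fun w) i (suc i ∷ U)))
-- n ≥ 1 and w ≠ w₀ only serve to make α(w) exist, which IsAlpha already asserts.
lemma6p1 n _ w _ λ′ dom i j ad α =
    ascent⇒<B (proj₁ ad) ascent
  , ascent⇒suc∈φ ascent
  , (λ _ → InPhi-s)
  , (λ U U↑ → descent⇔≤B⇔∈ (Perm-injective w) ascent (Linked⇒AllPairs <-trans U↑))
  , λ U U↑ U≢[] φU →
      wU-sᵢ-descent⇔ (Perm-injective w) ascent (Linked⇒AllPairs <-trans U↑) U≢[] φU
    , λ _ x → wU-s-conj (fun w) U x (All.map proj₁ φU)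
  where
  ascent : fun w i < fun w (suc i)
  ascent = ascent-at-alpha {w = w} dom ad α
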